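{- Let $T$ be a text over $\Sigma$ and consider its implicit suffix tree. Let $(u,d)$ be an implicit node with $d=\mathrm{depth}(u)$ and $u$ a branching node. Let $(q,\ell)$ be another implicit node such that $\mathrm{str}(q)[1\ldots\ell] = x\cdot\mathrm{str}(u)[1\ldots d]$ for some $x\in\Sigma$, and let $w:=\mathrm{parent}(q)$. If there exists a proper ancestor $v$ of $u$ (possibly the root) such that $\mathrm{wlink}(v,x)$ exists, then $w=\mathrm{wlink}(v^*,x)$, where $v^*$ is the lowest (deepest) such proper ancestor of $u$; otherwise $w$ is the root.
   Context: $\Sigma$ is a constant-size alphabet; a suffix of $T$ is repeated if it occurs at least twice in $T$. The implicit suffix tree of $T$ is the compacted trie of all suffixes of $T$ (no sentinel): from the trie of all suffixes, keep as explicit nodes only the root, the branching nodes (non-root nodes with at least two children) and the leaves (trie nodes with no children), compressing every other path into a single labelled edge. For a node $u$: $\mathrm{str}(u)$ is the concatenated edge labels from the root to $u$, $\mathrm{depth}(u)=|\mathrm{str}(u)|$, $\mathrm{parent}(u)$ its parent. A locus is a pair $(u,d)$, $u$ non-root, with $\mathrm{depth}(\mathrm{parent}(u))<d\le\mathrm{depth}(u)$, representing $\mathrm{str}(u)[1\ldots d]$; an implicit node is a locus $(u,d)$ with $\mathrm{str}(u)[1\ldots d]$ a repeated suffix of $T$. Weiner links: for a node $v$ (the root or a branching node) and $x\in\Sigma$, $\mathrm{wlink}(v,x)$ is the branching node $v'$ with $\mathrm{str}(v') = x\cdot\mathrm{str}(v)$, if such a branching node exists (otherwise $\mathrm{wlink}(v,x)$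 does not exist). -}

module Defs where

open import Data.Nat using (ℕ; _<_; _≤_)
open import Data.Fin using (Fin)
open import Data.List using (List; []; _∷_; _++_; length; take; [_])
open import Data.Product using (Σ; ∃; ∃-syntax; _×_; _,_)
open import Data.Sum using (_⊎_)
open import Relation.Nullary using (¬_)
open import Relation.Binary.PropositionalEquality using (_≡_; _≢_)

Str : ℕ → Set
Str σ = List (Fin σ)

module _ {σ : ℕ} where

  -- s occurs in T (s is a substring of T)  =  s is a node of the suffix trie of T
  Substr : Str σ → Str σ → Set
  Substr T s = ∃[ a ] ∃[ b ] (T ≡ a ++ s ++ b)

  Suffix : Str σ → Str σ → Set
  Suffix T s = ∃[ a ] (T ≡ a ++ s)

  OccursTwice : Str σ → Str σ → Set
  OccursTwice T s = ∃[ a ] ∃[ b ] ∃[ a' ] ∃[ b' ]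
    (T ≡ a ++ s ++ b × T ≡ a' ++ s ++ b' × length a ≢ length a')

  RepeatedSuffix : Str σ → Str σ → Set
  RepeatedSuffix T s = Suffix T s × OccursTwice T s

  -- In the trie of all suffixes of T, a node is identified with its string
  -- (a substring of T); its children are s ++ [ c ] for letters c with
  -- s ++ [ c ] a substring.

  Branching : Str σ → Str σ → Set
  Branching T s = s ≢ [] × Substr T s ×
    (∃[ c ] ∃[ c' ] (c ≢ c' × Substr T (s ++ [ c ]) × Substr T (s ++ [ c' ])))

  Leaf : Str σ → Str σ → Set
  Leaf T s = Substr T s × (∀ c → ¬ Substr T (s ++ [ c ]))

  -- explicit nodes of the implicit suffix tree: root, branching nodes, leaves
  Node : Str σ → Str σ → Set
  Node T s = s ≡ [] ⊎ Branching T s ⊎ Leaf T s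

  ProperPrefix : Str σ → Str σ → Set
  ProperPrefix p s = ∃[ r ] (r ≢ [] × s ≡ p ++ r)

  ProperAncestor : Str σ → Str σ → Str σ → Set
  ProperAncestor T v u = Node T v × Node T u × ProperPrefix v u

  IsParent : Str σ → Str σ → Str σ → Set
  IsParent T p u = u ≢ [] × ProperAncestor T p u ×
    (∀ v → ProperAncestor T v u → length v ≤ length p)

  Locus : Str σ → Str σ → ℕ → Set
  Locus T u d = Node T u × u ≢ [] ×
    (∀ p → IsParent T p u → length p < d) × d ≤ length u

  ImplicitNode : Str σ → Str σ → ℕ → Set
  ImplicitNode T u d = Locus T u d × RepeatedSuffix T (take d u)

  WLink : Str σ → Str σ → Fin σ → Str σ → Set
  WLink T v x v' = (v ≡ [] ⊎ Branching T v) × Branching T v' × v' ≡ x ∷ v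

  WLinkExists : Str σ → Str σ → Fin σ → Set
  WLinkExists T v x = ∃[ v' ] WLink T v x v'

  LowestWLinkAncestor : Str σ → Str σ → Fin σ → Str σ → Set
  LowestWLinkAncestor T u x vs = ProperAncestor T vs u × WLinkExists T vs x ×
    (∀ v → ProperAncestor T v u → WLinkExists T v x → length v ≤ length vs)

-- Write q = x·u·r.  The parent w of q is strictly shorter than x·u, so it is a
-- proper prefix of x·u: either the root, or w = x·w' with w' a proper prefix of u.
-- In the second case w is an inner node, hence branching, and dropping its first
-- letter keeps it branching, so w = wlink(w', x) for the proper ancestor w' of u.
-- Conversely, if wlink(v*, x) = x·v* exists, it is a node strictly above q, so the
-- parent w is at least as deep; thus w is not the root, and w' is a wlink-ancestor
-- at least as deep as v*, so w' = v* by the choice of v*.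
module Submission where

open import Defs
open import Data.Nat using (ℕ; suc; _<_; _≤_; s≤s)
open import Data.Nat.Properties using (≤-antisym; ≤-refl; suc-injective; m≤n⇒m⊓n≡m)
open import Data.Fin using (Fin)
open import Data.List using (List; []; _∷_; length; take; drop; _++_; [_])
open import Data.List.Properties
  using (∷-injective; length-take; take++drop≡id; take-all; ++-assoc; ++-conicalˡ; ++-conicalʳ)
open import Data.Product using (_×_; _,_; ∃-syntax; proj₁; proj₂)
open import Data.Sum using (_⊎_; inj₁; inj₂)
open import Data.Empty using (⊥-elim)
open import Relation.Nullary using (¬_)
open import Relation.Binary.PropositionalEquality
  using (_≡_; _≢_; refl; sym; trans; cong; subst)

module _ {A : Set} where

  ++-prefix-< : (a b r s : List A) → a ++ r ≡ b ++ s → length a < length b →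
                ∃[ t ] (t ≢ [] × b ≡ a ++ t)
  ++-prefix-< []      (y ∷ b) r s eq lt       = y ∷ b , (λ ()) , refl
  ++-prefix-< (x ∷ a) (y ∷ b) r s eq (s≤s lt) with ∷-injective eq
  ... | refl , eq′ with ++-prefix-< a b r s eq′ lt
  ... | t , t≢[] , b≡a++t = t , t≢[] , cong (x ∷_) b≡a++t

  ++-prefix-≡ : (a b r s : List A) → a ++ r ≡ b ++ s → length a ≡ length b → a ≡ b
  ++-prefix-≡ []      []      r s eq len = refl
  ++-prefix-≡ (x ∷ a) (y ∷ b) r s eq len with ∷-injective eq
  ... | refl , eq′ = cong (x ∷_) (++-prefix-≡ a b r s eq′ (suc-injective len))

  take-prefix : ∀ n (xs ys : List A) → take n xs ≡ ys → n ≤ length xs →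
                xs ≡ ys ++ drop n xs × length ys ≡ n
  take-prefix n xs ys take≡ n≤ =
    trans (sym (take++drop≡id n xs)) (cong (_++ drop n xs) take≡) ,
    trans (cong length (sym take≡)) (trans (length-take n xs) (m≤n⇒m⊓n≡m n≤))

module _ {σ : ℕ} where

  RootOrBranching : Str σ → Str σ → Set
  RootOrBranching T v = v ≡ [] ⊎ Branching T v

  RootOrBranching⇒Node : {T v : Str σ} → RootOrBranching T v → Node T v
  RootOrBranching⇒Node (inj₁ v≡[]) = inj₁ v≡[]
  RootOrBranching⇒Node (inj₂ b)    = inj₂ (inj₁ b)

  Substr-++⁻ˡ : (T s r : Str σ) → Substr T (s ++ r) → Substr T s
  Substr-++⁻ˡ T s r (a , b , eq) = a , r ++ b , trans eq (cong (a ++_) (++-assoc s r b))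

  Substr-∷⁻ : (T : Str σ) (x : Fin σ) (s : Str σ) → Substr T (x ∷ s) → Substr T s
  Substr-∷⁻ T x s (a , b , eq) = a ++ [ x ] , b , trans eq (sym (++-assoc a [ x ] (s ++ b)))

  Node⇒Substr : {T q : Str σ} → Node T q → q ≢ [] → Substr T q
  Node⇒Substr (inj₁ q≡[])                q≢[] = ⊥-elim (q≢[] q≡[])
  Node⇒Substr (inj₂ (inj₁ (_ , sub , _))) _    = sub
  Node⇒Substr (inj₂ (inj₂ (sub , _)))     _    = sub

  -- A non-root node strictly above another node has a child, so it is not a leaf.
  ProperPrefix-Node⇒Branching : {T w q : Str σ} → w ≢ [] → Node T w → Node T q →
                                ProperPrefix w q → Branching T w
  ProperPrefix-Node⇒Branching w≢[] (inj₁ w≡[])         _  _ = ⊥-elim (w≢[] w≡[])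
  ProperPrefix-Node⇒Branching _    (inj₂ (inj₁ b))     _  _ = b
  ProperPrefix-Node⇒Branching _    (inj₂ (inj₂ (_ , noChild))) _ ([] , r≢[] , _) =
    ⊥-elim (r≢[] refl)
  ProperPrefix-Node⇒Branching {T} {w} {q} _ (inj₂ (inj₂ (_ , noChild))) nq (c ∷ r , _ , q≡) =
    ⊥-elim (noChild c (Substr-++⁻ˡ T (w ++ [ c ]) r (subst (Substr T) q≡′ (Node⇒Substr nq q≢[]))))
    where
      q≡′ : q ≡ (w ++ [ c ]) ++ r
      q≡′ = trans q≡ (sym (++-assoc w [ c ] r))
      q≢[] : q ≢ []
      q≢[] q≡[] with ++-conicalʳ w (c ∷ r) (trans (sym q≡) q≡[])
      ... | ()

  Branching-∷⁻ : (T : Str σ) (x : Fin σ) (v : Str σ) → Branching T (x ∷ v) → RootOrBranching T v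
  Branching-∷⁻ T x []      _ = inj₁ refl
  Branching-∷⁻ T x (y ∷ v) (_ , sub , c , c′ , c≢c′ , sub-c , sub-c′) =
    inj₂ ((λ ()) , Substr-∷⁻ T x (y ∷ v) sub , c , c′ , c≢c′ ,
          Substr-∷⁻ T x (y ∷ v ++ [ c ]) sub-c , Substr-∷⁻ T x (y ∷ v ++ [ c′ ]) sub-c′)

  WLinkFromAncestor : Str σ → Str σ → Fin σ → Str σ → Set
  WLinkFromAncestor T u x w = ∃[ w′ ] (ProperAncestor T w′ u × WLink T w′ x w)

  module _ {T u q r : Str σ} {x : Fin σ}
           (nu : Node T u) (nq : Node T q) (q≡ : q ≡ (x ∷ u) ++ r) where

    parent-root-or-wlink : {w : Str σ} → IsParent T w q → length w < suc (length u) →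
                           w ≡ [] ⊎ WLinkFromAncestor T u x w
    parent-root-or-wlink {[]}     _ _ = inj₁ refl
    parent-root-or-wlink {y ∷ w′} (_ , (nw , _ , w⊏q@(s , _ , q≡w++s)) , _) w<
        with ++-prefix-< (y ∷ w′) (x ∷ u) s r (trans (sym q≡w++s) q≡) w<
    ... | t , t≢[] , x∷u≡w++t with ∷-injective x∷u≡w++t
    ... | refl , u≡w′++t =
      inj₂ (w′ , (RootOrBranching⇒Node rb , nu , t , t≢[] , u≡w′++t) , rb , bw , refl)
      where
        bw : Branching T (x ∷ w′)
        bw = ProperPrefix-Node⇒Branching (λ ()) nw nq w⊏q
        rb : RootOrBranching T w′
        rb = Branching-∷⁻ T x w′ bw

    wlink-ancestor-below-parent : {v w : Str σ} → IsParent T w q → ProperAncestor T v u →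
                                  WLinkExists T v x → suc (length v) ≤ length w
    wlink-ancestor-below-parent {v} (_ , _ , deepest) (_ , _ , t , t≢[] , u≡v++t) (_ , _ , bv′ , refl) =
      deepest (x ∷ v) (inj₂ (inj₁ bv′) , nq , t ++ r , t++r≢[] , q≡x∷v++t++r)
      where
        t++r≢[] : t ++ r ≢ []
        t++r≢[] eq = t≢[] (++-conicalˡ t r eq)
        q≡x∷v++t++r : q ≡ (x ∷ v) ++ t ++ r
        q≡x∷v++t++r = trans q≡ (cong (x ∷_) (trans (cong (_++ r) u≡v++t) (++-assoc v t r)))

  ProperAncestor-unique : {T u v v′ : Str σ} → ProperAncestor T v u → ProperAncestor T v′ u →
                          length v ≡ length v′ → v ≡ v′
  ProperAncestor-unique {v = v} {v′} (_ , _ , t , _ , u≡v++t) (_ , _ , t′ , _ , u≡v′++t′) =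
    ++-prefix-≡ v v′ t t′ (trans (sym u≡v++t) u≡v′++t′)

lemma7 : {σ : ℕ} (T u q w : Str σ) (d ℓ : ℕ) (x : Fin σ) →
    Branching T u → d ≡ length u → ImplicitNode T u d →
    ImplicitNode T q ℓ → take ℓ q ≡ x ∷ take d u →
    IsParent T w q →
    ((vs : Str σ) → LowestWLinkAncestor T u x vs → WLink T vs x w)
    × ((∀ v → ProperAncestor T v u → ¬ WLinkExists T v x) → w ≡ [])
lemma7 {σ} T u q w d ℓ x bu refl _ ((nq , _ , parent<ℓ , ℓ≤) , _) take≡ parent = lowest , none
  where
    nu : Node T u
    nu = inj₂ (inj₁ bu)
    x∷u⊑q : q ≡ (x ∷ u) ++ drop ℓ q × length (x ∷ u) ≡ ℓ
    x∷u⊑q = take-prefix ℓ q (x ∷ u) (trans take≡ (cong (x ∷_) (take-all _ u ≤-refl))) ℓ≤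
    q≡ : q ≡ (x ∷ u) ++ drop ℓ q
    q≡ = proj₁ x∷u⊑q
    shape : w ≡ [] ⊎ WLinkFromAncestor T u x w
    shape = parent-root-or-wlink nu nq q≡ parent
              (subst (length w <_) (sym (proj₂ x∷u⊑q)) (parent<ℓ w parent))

    lowest : (vs : Str σ) → LowestWLinkAncestor T u x vs → WLink T vs x w
    lowest vs (anc , link , deepest) with shape | wlink-ancestor-below-parent nu nq q≡ parent anc link
    ... | inj₁ refl                                | ()
    ... | inj₂ (w′ , anc′ , link′@(_ , _ , refl)) | s≤s vs≤w′ =
      subst (λ v → WLink T v x w)
            (ProperAncestor-unique anc′ anc (≤-antisym (deepest w′ anc′ (w , link′)) vs≤w′))
            link′

    none : (∀ v → ProperAncestor T v u → ¬ WLinkExists T v x) → w ≡ []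
    none noLink with shape
    ... | inj₁ w≡[]                = w≡[]
    ... | inj₂ (w′ , anc′ , link′) = ⊥-elim (noLink w′ anc′ (w , link′))
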